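{- Let $q=p^n$ with $p$ an odd prime, let $\alpha,\beta\in GF(q^2)$ with $\alpha\neq0$ and $4N(\alpha)+(\overline{\beta}-\beta)^2$ a non-square in $GF(q)$, let $\lambda\in\{1,w\}$ and $P_\lambda=[0,\lambda\epsilon,1]$. For $z\in GF(q^2)$ let $Q_z=[z,\,T(\alpha z^2)-\lambda\epsilon,\,1]$, and let $T_\lambda=\{z\in GF(q^2): 2\lambda\epsilon+\alpha z^2-\overline{\alpha}\,\overline{z}^2+(\beta-\overline{\beta})N(z)=0\}$ (so that $\tau_{P_\lambda}(U_{\alpha,\beta})=\{Q_z: z\in T_\lambda\}$). Let $x\neq y$ be elements of $T_\lambda$ and let $l_{x,y}$ be the line through $Q_x$ and $Q_y$. If $Q_z\in l_{x,y}$ for some $z\in T_\lambda$ and $T(\alpha x^2)=T(\alpha y^2)$, then $Q_{ -z}\in l_{x,y}$.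
   Context: $GF(q^2)=\{a+\epsilon b: a,b\in GF(q)\}$ with $\epsilon^2=w\in GF(q)$, $\epsilon\notin GF(q)$. For $x\in GF(q^2)$ write $\overline{x}=x^q$, $T(x)=x+\overline{x}$, $N(x)=x\overline{x}$. Points of $PG(2,q^2)$ are written $[a,b,c]$ (homogeneous coordinates). $P_\infty=[0,1,0]$. The orthogonal-Buekenhout-Metz unital is $U_{\alpha,\beta}=\{[x,\alpha x^2+\beta N(x)+r,1]: x\in GF(q^2), r\in GF(q)\}\cup\{P_\infty\}$. For a point $P\notin U_{\alpha,\beta}$, $\tau_P(U_{\alpha,\beta})$ denotes the set of $q+1$ points of contact with $U_{\alpha,\beta}$ of the tangent lines (lines meeting $U_{\alpha,\beta}$ in exactly one point) through $P$. -}

module Defs where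

open import Data.Nat using (ℕ; zero; suc)
open import Data.Fin using (Fin)
open import Data.Product using (_×_; _,_; ∃; ∃-syntax; proj₁; proj₂)
open import Data.Sum using (_⊎_)
open import Relation.Nullary using (¬_)
open import Relation.Binary.PropositionalEquality using (_≡_)
open import Function.Bundles using (_↔_)
open import Algebra.Structures using (IsCommutativeRing)

record FiniteField (q : ℕ) : Set₁ where
  infixl 6 _+_
  infixl 7 _*_
  field
    F          : Set
    _+_ _*_    : F → F → F
    -_         : F → F
    0# 1#      : F
    isCommRing : IsCommutativeRing _≡_ _+_ _*_ -_ 0# 1#
    0≢1        : ¬ (0# ≡ 1#)
    inverse    : ∀ x → ¬ (x ≡ 0#) → ∃[ y ] (x * y ≡ 1#)
    enumerate  : F ↔ Fin q

module _ {q : ℕ} (K : FiniteField q) where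
  open FiniteField K
  NonSquare : F → Set
  NonSquare a = ¬ (∃[ s ] (s * s ≡ a))

-- The quadratic extension GF(q^2) = { a + ε b : a, b ∈ GF(q) }, ε² = w,
-- where w is a non-square of GF(q).  An element a + ε b is the pair (a , b).
module Ext {q : ℕ} (K : FiniteField q) (w : FiniteField.F K) where
  open FiniteField K

  E : Set
  E = F × F

  ι : F → E
  ι a = a , 0#

  ε : E
  ε = 0# , 1#

  0E 1E : E
  0E = ι 0#
  1E = ι 1#

  infixl 6 _⊕_ _⊖_
  infixl 7 _⊗_
  _⊕_ : E → E → E
  (a , b) ⊕ (c , d) = (a + c) , (b + d)

  ⊝_ : E → E
  ⊝ (a , b) = (- a) , (- b)

  _⊖_ : E → E → E
  x ⊖ y = x ⊕ (⊝ y)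

  -- (a + εb)(c + εd) = (ac + w bd) + ε(ad + bc)
  _⊗_ : E → E → E
  (a , b) ⊗ (c , d) = (a * c + w * (b * d)) , (a * d + b * c)

  _^_ : E → ℕ → E
  x ^ zero  = 1E
  x ^ suc k = x ⊗ (x ^ k)

  conj : E → E
  conj x = x ^ q

  T : E → E
  T x = x ⊕ conj x

  N : E → E
  N x = x ⊗ conj x

  NonSquareInGFq : E → Set
  NonSquareInGFq x = ¬ (∃[ s ] (ι (s * s) ≡ x))

  four : E
  four = 1E ⊕ 1E ⊕ 1E ⊕ 1E

  -- Points of PG(2,q^2) are given by homogeneous coordinate triples.
  Vec3 : Set
  Vec3 = E × E × E

  OnLineThrough : Vec3 → Vec3 → Vec3 → Set
  OnLineThrough (a₁ , a₂ , a₃) (b₁ , b₂ , b₃) (c₁ , c₂ , c₃) =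
    ∃[ s ] ∃[ t ] ((c₁ ≡ s ⊗ a₁ ⊕ t ⊗ b₁) × (c₂ ≡ s ⊗ a₂ ⊕ t ⊗ b₂) × (c₃ ≡ s ⊗ a₃ ⊕ t ⊗ b₃))

  Q : (α lam z : E) → Vec3
  Q α lam z = z , (T (α ⊗ (z ⊗ z)) ⊖ lam ⊗ ε) , 1E

  InTλ : (α β lam z : E) → Set
  InTλ α β lam z =
    (1E ⊕ 1E) ⊗ lam ⊗ ε ⊕ α ⊗ (z ⊗ z) ⊖ conj α ⊗ (conj z ⊗ conj z)
      ⊕ (β ⊖ conj β) ⊗ N z ≡ 0E

module Submission where

-- Q_x and Q_y have the same second coordinate h (this is what T(αx²) = T(αy²) says), so the line
-- through them is Y = hZ: as x − y is invertible in the field GF(q)[ε], every point [u, h, 1] is an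
-- affine combination of Q_x and Q_y. A point Q_u lies on this line exactly when T(αu²) − λε = h,
-- which depends on u only through u², so Q_z ∈ l_{x,y} gives Q_{−z} ∈ l_{x,y}.

open import Defs
open import Data.Nat using (ℕ; _^_; _≤_)
open import Data.Nat.Primality using (Prime)
open import Data.Sum using (_⊎_)
open import Data.Fin.Properties using () renaming (_≟_ to _≟ᶠ_)
open import Data.Product using (_×_; _,_; ∃-syntax; proj₂; uncurry)
open import Data.Empty using (⊥-elim)
open import Function using (_∘_)
open import Relation.Nullary using (¬_; yes; no)
open import Relation.Nullary.Decidable using (via-injection)
open import Relation.Binary.Definitions using (DecidableEquality)
open import Relation.Binary.PropositionalEquality
open import Function.Properties.Inverse using (↔⇒↣)
open import Algebra.Bundles using (CommutativeRing)
open import Algebra.Structures using (IsCommutativeRing)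
import Algebra.Solver.Ring.NaturalCoefficients.Default as RingSolver

module FiniteFieldProperties {q : ℕ} (K : FiniteField q) where
  open FiniteField K

  commutativeRing : CommutativeRing _ _
  commutativeRing = record { isCommutativeRing = isCommRing }

  open CommutativeRing commutativeRing public
    using ( +-assoc; +-comm; +-identityˡ; +-identityʳ; -‿inverseˡ; -‿inverseʳ
          ; *-comm; *-identityʳ; zeroˡ; ring)
  open import Algebra.Properties.Ring ring public using (x∙y⁻¹≈ε⇒x≈y; -‿distribʳ-*)

  _≟_ : DecidableEquality F
  _≟_ = via-injection (↔⇒↣ enumerate) _≟ᶠ_

  open RingSolver (CommutativeRing.commutativeSemiring commutativeRing) public
    using (solve; _:=_; _:+_; _:*_; con)

  square≡0⇒≡0 : ∀ a → a * a ≡ 0# → a ≡ 0#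
  square≡0⇒≡0 a a²≡0 with a ≟ 0#
  ... | yes a≡0 = a≡0
  ... | no a≢0 with inverse a a≢0
  ... | a⁻¹ , aa⁻¹≡1 = ⊥-elim (0≢1 (begin
        0#                    ≡⟨ sym (zeroˡ (a⁻¹ * a⁻¹)) ⟩
        0# * (a⁻¹ * a⁻¹)      ≡⟨ cong (_* (a⁻¹ * a⁻¹)) a²≡0 ⟨
        a * a * (a⁻¹ * a⁻¹)   ≡⟨ solve 2 (λ a b → a :* a :* (b :* b) := a :* b :* (a :* b)) refl a a⁻¹ ⟩
        a * a⁻¹ * (a * a⁻¹)   ≡⟨ cong₂ _*_ aa⁻¹≡1 aa⁻¹≡1 ⟩
        1# * 1#               ≡⟨ *-identityʳ 1# ⟩
        1#                    ∎))
    where open ≡-Reasoning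

  module _ {w : F} (w-nonSquare : NonSquare K w) where

    a²≡wb²⇒a≡0×b≡0 : ∀ a b → a * a ≡ w * (b * b) → a ≡ 0# × b ≡ 0#
    a²≡wb²⇒a≡0×b≡0 a b a²≡wb² with b ≟ 0#
    ... | yes refl =
      square≡0⇒≡0 a (trans a²≡wb² (solve 1 (λ w → w :* (con 0 :* con 0) := con 0) refl w)) , refl
    ... | no b≢0 with inverse b b≢0
    ... | b⁻¹ , bb⁻¹≡1 = ⊥-elim (w-nonSquare (a * b⁻¹ , (begin
          a * b⁻¹ * (a * b⁻¹)        ≡⟨ solve 2 (λ a c → a :* c :* (a :* c) := a :* a :* (c :* c)) refl a b⁻¹ ⟩
          a * a * (b⁻¹ * b⁻¹)        ≡⟨ cong (_* (b⁻¹ * b⁻¹)) a²≡wb² ⟩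
          w * (b * b) * (b⁻¹ * b⁻¹)  ≡⟨ solve 3 (λ w b c → w :* (b :* b) :* (c :* c) := w :* (b :* c :* (b :* c))) refl w b b⁻¹ ⟩
          w * (b * b⁻¹ * (b * b⁻¹))  ≡⟨ cong (λ u → w * (u * u)) bb⁻¹≡1 ⟩
          w * (1# * 1#)              ≡⟨ solve 1 (λ w → w :* (con 1 :* con 1) := w) refl w ⟩
          w                          ∎)))
      where open ≡-Reasoning

module QuadraticExtension {q : ℕ} (K : FiniteField q) (w : FiniteField.F K) where
  open FiniteField K
  open FiniteFieldProperties K hiding (commutativeRing)
  open Ext K w

  isCommutativeRing : IsCommutativeRing _≡_ _⊕_ _⊗_ ⊝_ 0E 1E
  isCommutativeRing = record
    { isRing = record
      { +-isAbelianGroup = record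
        { isGroup = record
          { isMonoid = record
            { isSemigroup = record
              { isMagma = record { isEquivalence = isEquivalence ; ∙-cong = cong₂ _⊕_ }
              ; assoc   = λ (a , b) (c , d) (e , f) → cong₂ _,_ (+-assoc a c e) (+-assoc b d f)
              }
            ; identity = (λ (a , b) → cong₂ _,_ (+-identityˡ a) (+-identityˡ b))
                       , (λ (a , b) → cong₂ _,_ (+-identityʳ a) (+-identityʳ b))
            }
          ; inverse = (λ (a , b) → cong₂ _,_ (-‿inverseˡ a) (-‿inverseˡ b))
                    , (λ (a , b) → cong₂ _,_ (-‿inverseʳ a) (-‿inverseʳ b))
          ; ⁻¹-cong = cong ⊝_
          }
        ; comm = λ (a , b) (c , d) → cong₂ _,_ (+-comm a c) (+-comm b d)
        }
      ; *-cong = cong₂ _⊗_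
      ; *-assoc = λ (a , b) (c , d) (e , f) → cong₂ _,_
          (solve 7 (λ a b c d e f w →
             (a :* c :+ w :* (b :* d)) :* e :+ w :* ((a :* d :+ b :* c) :* f)
             := a :* (c :* e :+ w :* (d :* f)) :+ w :* (b :* (c :* f :+ d :* e))) refl a b c d e f w)
          (solve 7 (λ a b c d e f w →
             (a :* c :+ w :* (b :* d)) :* f :+ (a :* d :+ b :* c) :* e
             := a :* (c :* f :+ d :* e) :+ b :* (c :* e :+ w :* (d :* f))) refl a b c d e f w)
      ; *-identity = (λ (a , b) → cong₂ _,_
                        (solve 3 (λ a b w → con 1 :* a :+ w :* (con 0 :* b) := a) refl a b w)
                        (solve 2 (λ a b → con 1 :* b :+ con 0 :* a := b) refl a b))
                   , (λ (a , b) → cong₂ _,_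
                        (solve 3 (λ a b w → a :* con 1 :+ w :* (b :* con 0) := a) refl a b w)
                        (solve 2 (λ a b → a :* con 0 :+ b :* con 1 := b) refl a b))
      ; distrib = (λ (a , b) (c , d) (e , f) → cong₂ _,_
                     (solve 7 (λ a b c d e f w →
                        a :* (c :+ e) :+ w :* (b :* (d :+ f))
                        := (a :* c :+ w :* (b :* d)) :+ (a :* e :+ w :* (b :* f))) refl a b c d e f w)
                     (solve 6 (λ a b c d e f →
                        a :* (d :+ f) :+ b :* (c :+ e)
                        := (a :* d :+ b :* c) :+ (a :* f :+ b :* e)) refl a b c d e f))
                , (λ (a , b) (c , d) (e , f) → cong₂ _,_
                     (solve 7 (λ a b c d e f w →
                        (c :+ e) :* a :+ w :* ((d :+ f) :* b)
                        := (c :* a :+ w :* (d :* b)) :+ (e :* a :+ w :* (f :* b))) refl a b c d e f w)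
                     (solve 6 (λ a b c d e f →
                        (c :+ e) :* b :+ (d :+ f) :* a
                        := (c :* b :+ d :* a) :+ (e :* b :+ f :* a)) refl a b c d e f))
      }
    ; *-comm = λ (a , b) (c , d) → cong₂ _,_
        (solve 5 (λ a b c d w → a :* c :+ w :* (b :* d) := c :* a :+ w :* (d :* b)) refl a b c d w)
        (solve 4 (λ a b c d → a :* d :+ b :* c := c :* b :+ d :* a) refl a b c d)
    }

  commutativeRing : CommutativeRing _ _
  commutativeRing = record { isCommutativeRing = isCommutativeRing }

  open CommutativeRing commutativeRing using () renaming (*-assoc to ⊗-assoc)

  ι-* : ∀ a b → ι a ⊗ ι b ≡ ι (a * b)
  ι-* a b = cong₂ _,_
    (solve 3 (λ a b w → a :* b :+ w :* (con 0 :* con 0) := a :* b) refl a b w)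
    (solve 2 (λ a b → a :* con 0 :+ con 0 :* b := con 0) refl a b)

  norm : E → F
  norm (a , b) = a * a + - (w * (b * b))

  ⊗-conjugate : ∀ a b → (a , b) ⊗ (a , - b) ≡ ι (norm (a , b))
  ⊗-conjugate a b = cong₂ _,_
    (cong (a * a +_) (begin
       w * (b * - b)    ≡⟨ cong (w *_) (-‿distribʳ-* b b) ⟨
       w * - (b * b)    ≡⟨ -‿distribʳ-* w (b * b) ⟨
       - (w * (b * b))  ∎))
    (begin
       a * - b + b * a    ≡⟨ cong₂ _+_ (-‿distribʳ-* a b) (*-comm a b) ⟨
       - (a * b) + a * b  ≡⟨ -‿inverseˡ (a * b) ⟩
       0#                 ∎)
    where open ≡-Reasoning

  norm≢0 : NonSquare K w → ∀ d → ¬ d ≡ 0E → ¬ norm d ≡ 0#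
  norm≢0 w-nonSquare (a , b) d≢0 norm≡0 = d≢0 (uncurry (cong₂ _,_)
    (a²≡wb²⇒a≡0×b≡0 w-nonSquare a b (x∙y⁻¹≈ε⇒x≈y (a * a) (w * (b * b)) norm≡0)))

  ⊗-inverse : NonSquare K w → ∀ d → ¬ d ≡ 0E → ∃[ d⁻¹ ] d ⊗ d⁻¹ ≡ 1E
  ⊗-inverse w-nonSquare (a , b) d≢0 with inverse (norm (a , b)) (norm≢0 w-nonSquare (a , b) d≢0)
  ... | n⁻¹ , nn⁻¹≡1 = (a , - b) ⊗ ι n⁻¹ , (begin
    (a , b) ⊗ ((a , - b) ⊗ ι n⁻¹)  ≡⟨ ⊗-assoc (a , b) (a , - b) (ι n⁻¹) ⟨
    (a , b) ⊗ (a , - b) ⊗ ι n⁻¹    ≡⟨ cong (_⊗ ι n⁻¹) (⊗-conjugate a b) ⟩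
    ι (norm (a , b)) ⊗ ι n⁻¹       ≡⟨ ι-* (norm (a , b)) n⁻¹ ⟩
    ι (norm (a , b) * n⁻¹)         ≡⟨ cong ι nn⁻¹≡1 ⟩
    1E                             ∎)
    where open ≡-Reasoning

module ExtensionPlane {q : ℕ} (K : FiniteField q) (w : FiniteField.F K) where
  open Ext K w
  open QuadraticExtension K w using (commutativeRing; ⊗-inverse)
  open CommutativeRing commutativeRing
    using (+-comm; *-identityˡ; *-identityʳ; distribʳ; ring; commutativeSemiring)
  open import Algebra.Properties.Ring ring
    using (//-rightDividesˡ; x∙y⁻¹≈ε⇒x≈y; -‿distribˡ-*; -‿distribʳ-*; -‿involutive)
  open RingSolver commutativeSemiring using (solve; _:=_; _:+_; _:*_)
  open ≡-Reasoning

  ⊝x⊗⊝x≡x⊗x : ∀ x → ⊝ x ⊗ ⊝ x ≡ x ⊗ x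
  ⊝x⊗⊝x≡x⊗x x = begin
    ⊝ x ⊗ ⊝ x      ≡⟨ -‿distribˡ-* x (⊝ x) ⟨
    ⊝ (x ⊗ ⊝ x)    ≡⟨ cong ⊝_ (-‿distribʳ-* x x) ⟨
    ⊝ ⊝ (x ⊗ x)    ≡⟨ -‿involutive (x ⊗ x) ⟩
    x ⊗ x          ∎

  s⊕t≡1⇒s⊗h⊕t⊗h≡h : ∀ {s t} → s ⊕ t ≡ 1E → ∀ h → s ⊗ h ⊕ t ⊗ h ≡ h
  s⊕t≡1⇒s⊗h⊕t⊗h≡h {s} {t} s+t≡1 h = begin
    s ⊗ h ⊕ t ⊗ h  ≡⟨ distribʳ h s t ⟨
    (s ⊕ t) ⊗ h    ≡⟨ cong (_⊗ h) s+t≡1 ⟩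
    1E ⊗ h         ≡⟨ *-identityˡ h ⟩
    h              ∎

  onLine⇒height≡ : ∀ {x y z h₁ h₂ k} → h₁ ≡ h₂ →
    OnLineThrough (x , h₁ , 1E) (y , h₂ , 1E) (z , k , 1E) → k ≡ h₁
  onLine⇒height≡ {h₁ = h₁} refl (s , t , _ , k≡sh+th , 1≡s+t) =
    trans k≡sh+th (s⊕t≡1⇒s⊗h⊕t⊗h≡h s+t≡1 h₁)
    where
    s+t≡1 : s ⊕ t ≡ 1E
    s+t≡1 = trans (cong₂ _⊕_ (sym (*-identityʳ s)) (sym (*-identityʳ t))) (sym 1≡s+t)

  unit-difference⇒onLine : ∀ {x y z h₁ h₂ k i} → (x ⊖ y) ⊗ i ≡ 1E → h₁ ≡ h₂ → k ≡ h₁ →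
    OnLineThrough (x , h₁ , 1E) (y , h₂ , 1E) (z , k , 1E)
  unit-difference⇒onLine {x} {y} {z} {h₁} {i = i} di≡1 refl k≡h₁ =
    s , t , sym z≡sx+ty , trans k≡h₁ (sym (s⊕t≡1⇒s⊗h⊕t⊗h≡h s+t≡1 h₁))
    , sym (s⊕t≡1⇒s⊗h⊕t⊗h≡h s+t≡1 1E)
    where
    d = x ⊖ y
    u = z ⊖ y
    s = u ⊗ i
    t = 1E ⊖ s
    s+t≡1 : s ⊕ t ≡ 1E
    s+t≡1 = trans (+-comm s t) (//-rightDividesˡ s 1E)
    z≡sx+ty : s ⊗ x ⊕ t ⊗ y ≡ z
    z≡sx+ty = begin
      s ⊗ x ⊕ t ⊗ y            ≡⟨ cong (λ v → s ⊗ v ⊕ t ⊗ y) (//-rightDividesˡ y x) ⟨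
      s ⊗ (d ⊕ y) ⊕ t ⊗ y      ≡⟨ solve 5 (λ u i d y t → u :* i :* (d :+ y) :+ t :* y
                                      := u :* (d :* i) :+ (u :* i :+ t) :* y) refl u i d y t ⟩
      u ⊗ (d ⊗ i) ⊕ (s ⊕ t) ⊗ y ≡⟨ cong₂ (λ a b → u ⊗ a ⊕ b ⊗ y) di≡1 s+t≡1 ⟩
      u ⊗ 1E ⊕ 1E ⊗ y          ≡⟨ cong₂ _⊕_ (*-identityʳ u) (*-identityˡ y) ⟩
      u ⊕ y                    ≡⟨ //-rightDividesˡ y z ⟩
      z                        ∎

  height≡⇒onLine : NonSquare K w → ∀ {x y z h₁ h₂ k} → ¬ x ≡ y → h₁ ≡ h₂ → k ≡ h₁ →
    OnLineThrough (x , h₁ , 1E) (y , h₂ , 1E) (z , k , 1E)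
  height≡⇒onLine w-nonSquare {x} {y} x≢y =
    unit-difference⇒onLine (proj₂ (⊗-inverse w-nonSquare (x ⊖ y) (x≢y ∘ x∙y⁻¹≈ε⇒x≈y x y)))

mainTheorem9 :
    (p n : ℕ) → Prime p → ¬ (p ≡ 2) → 1 ≤ n →
    (K : FiniteField (p ^ n)) →
    (w : FiniteField.F K) → NonSquare K w →
    (α β : Ext.E K w) → ¬ (α ≡ Ext.0E K w) →
    Ext.NonSquareInGFq K w
      (Ext._⊕_ K w (Ext._⊗_ K w (Ext.four K w) (Ext.N K w α))
        (Ext._⊗_ K w (Ext._⊖_ K w (Ext.conj K w β) β) (Ext._⊖_ K w (Ext.conj K w β) β))) →
    (lam : Ext.E K w) → (lam ≡ Ext.1E K w ⊎ lam ≡ Ext.ι K w w) →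
    (x y z : Ext.E K w) → ¬ (x ≡ y) →
    Ext.InTλ K w α β lam x → Ext.InTλ K w α β lam y → Ext.InTλ K w α β lam z →
    Ext.OnLineThrough K w (Ext.Q K w α lam x) (Ext.Q K w α lam y) (Ext.Q K w α lam z) →
    Ext.T K w (Ext._⊗_ K w α (Ext._⊗_ K w x x)) ≡ Ext.T K w (Ext._⊗_ K w α (Ext._⊗_ K w y y)) →
    Ext.OnLineThrough K w (Ext.Q K w α lam x) (Ext.Q K w α lam y) (Ext.Q K w α lam (Ext.⊝_ K w z))
mainTheorem9 _ _ _ _ _ K w w-nonSquare α _ _ _ lam _ x y z x≢y _ _ _ Qz∈l T[αx²]≡T[αy²] =
  height≡⇒onLine w-nonSquare x≢y height-x≡height-y (trans height-⊝z≡height-z height-z≡height-x)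
  where
  open Ext K w
  open ExtensionPlane K w using (⊝x⊗⊝x≡x⊗x; onLine⇒height≡; height≡⇒onLine)

  height : E → E
  height u = T (α ⊗ (u ⊗ u)) ⊖ lam ⊗ ε

  height-x≡height-y : height x ≡ height y
  height-x≡height-y = cong (_⊖ lam ⊗ ε) T[αx²]≡T[αy²]

  height-z≡height-x : height z ≡ height x
  height-z≡height-x = onLine⇒height≡ height-x≡height-y Qz∈l

  height-⊝z≡height-z : height (⊝ z) ≡ height z
  height-⊝z≡height-z = cong (λ v → T (α ⊗ v) ⊖ lam ⊗ ε) (⊝x⊗⊝x≡x⊗x z)
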